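{- Under the standing setting below, for $l\in S$ and $r\ge0$ let $B_l=\{s\in S: d(s,l)\le r\}$. If $r<4d_{\mathrm{crit}}$, then a ball $B_l$ of radius $r$ cannot contain points from more than one good set $X_i$, and two balls $B_{l_1},B_{l_2}$ of radius $r$ that intersect different good sets $X_i$ and $X_j$ ($i\ne j$) satisfy $B_{l_1}\cap B_{l_2}=\emptyset$.
   Context: Standing setting: $(S,d)$ is a finite metric space, $n=|S|$, $k\ge1$, $\alpha>0$, $\epsilon>0$. The $k$-median objective of a $k$-clustering $C=\{C_1,\dots,C_k\}$ of $S$ is $\Phi(C)=\sum_i\sum_{x\in C_i}d(x,c_i)$, where the median $c_i$ is a point $y\in C_i$ minimizing $\sum_{x\in C_i}d(x,y)$; $\mathrm{OPT}=\min_C\Phi(C)$. $\mathrm{dist}(C,C')=\min_\sigma\frac1n\sum_i|C_i\setminus C'_{\sigma(i)}|$ over bijections $\sigma$ of $\{1,\dots,k\}$. $(S,d)$ satisfies the $(1+\alpha,\epsilon)$-property for $k$-median with respect to a target $k$-clustering $C_T$: every $k$-clustering $C$ with $\Phi(C)\le(1+\alpha)\mathrm{OPT}$ has $\mathrm{dist}(C,C_T)<\epsilon$; moreover every cluster of $C_T$ has size at least $(4+51/\alpha)\epsilon n$. Fix an optimal $k$-median clustering $C^*=\{C^*_1,\dots,C^*_k\}$ with medians $c^*_1,\dots,c^*_k$. For $x\in S$: $w(x)=\min_i d(x,c^*_i)$, $w_2(x)$ is the distance from $x$ to its second-closest point among $c^*_1,\dots,c^*_k$, and $w=\mathrm{OPT}/n$.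 Let $d_{\mathrm{crit}}=\frac{\alpha w}{17\epsilon}$. A point is good if $w(x)<d_{\mathrm{crit}}$ and $w_2(x)-w(x)\ge17d_{\mathrm{crit}}$, bad otherwise; the good set $X_i$ is the set of good points of $C^*_i$. -}

module Defs where

open import Data.Nat as ℕ using (ℕ; zero; suc)
open import Data.Fin using (Fin; zero; suc; _≟_)
open import Data.Bool using (Bool; if_then_else_; _∧_; not)
open import Data.Product using (Σ; ∃; ∃-syntax; _×_; _,_)
open import Relation.Binary.PropositionalEquality using (_≡_; _≢_)
open import Relation.Nullary using (¬_; does)
open import Algebra.Structures using (IsCommutativeRing)
open import Relation.Binary.Structures using (IsTotalOrder)
open import Function.Definitions using (Bijective)

-- An ordered field (the paper's distances and parameters are reals; we work
-- over an arbitrary ordered field, of which ℝ is an instance).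
record OrderedField : Set₁ where
  infixl 6 _+_ _-_
  infixl 7 _*_ _/_
  infix 8 -_
  infix 9 _⁻¹
  infix 4 _≤_ _<_
  field
    Carrier           : Set
    _+_ _*_           : Carrier → Carrier → Carrier
    -_                : Carrier → Carrier
    0# 1#             : Carrier
    _⁻¹               : Carrier → Carrier
    _≤_               : Carrier → Carrier → Set
    isCommutativeRing : IsCommutativeRing _≡_ _+_ _*_ -_ 0# 1#
    0≢1               : 0# ≢ 1#
    ⁻¹-inverse        : ∀ x → x ≢ 0# → x * (x ⁻¹) ≡ 1#
    isTotalOrder      : IsTotalOrder _≡_ _≤_
    +-mono-≤          : ∀ {x y} z → x ≤ y → x + z ≤ y + z
    *-nonneg          : ∀ {x y} → 0# ≤ x → 0# ≤ y → 0# ≤ x * y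

  _<_ : Carrier → Carrier → Set
  x < y = x ≤ y × x ≢ y

  _-_ : Carrier → Carrier → Carrier
  x - y = x + (- y)

  _/_ : Carrier → Carrier → Carrier
  x / y = x * (y ⁻¹)

  fromℕ : ℕ → Carrier
  fromℕ zero    = 0#
  fromℕ (suc m) = 1# + fromℕ m

module _ {A : Set} (0a : A) (_⊕_ : A → A → A) where
  foldFin : ∀ {m} → (Fin m → A) → A
  foldFin {zero}  f = 0a
  foldFin {suc m} f = f zero ⊕ foldFin (λ i → f (suc i))

count : ∀ {m} → (Fin m → Bool) → ℕ
count p = foldFin 0 ℕ._+_ (λ i → if p i then 1 else 0)

module KMedian (F : OrderedField) where
  open OrderedField F

  sumFin : ∀ {m} → (Fin m → Carrier) → Carrier
  sumFin = foldFin 0# _+_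

  record IsMetric {n : ℕ} (d : Fin n → Fin n → Carrier) : Set where
    field
      refl-0   : ∀ x → d x x ≡ 0#
      0⇒eq     : ∀ x y → d x y ≡ 0# → x ≡ y
      symm     : ∀ x y → d x y ≡ d y x
      triangle : ∀ x y z → d x z ≤ d x y + d y z

  Ball : ∀ {n} → (Fin n → Fin n → Carrier) → Fin n → Carrier → Fin n → Set
  Ball d l r s = d s l ≤ r

  module _ {n k : ℕ} (d : Fin n → Fin n → Carrier) where
    -- A k-clustering of S = Fin n: each point is assigned its cluster index;
    -- C_i = { x | C x ≡ i }.  Clusters are required to be nonempty.
    IsKClustering : (Fin n → Fin k) → Set
    IsKClustering C = ∀ i → ∃[ x ] C x ≡ i

    sumIn : (Fin n → Fin k) → Fin k → (Fin n → Carrier) → Carrier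
    sumIn C i f = sumFin (λ x → if does (C x ≟ i) then f x else 0#)

    IsMedian : (Fin n → Fin k) → Fin k → Fin n → Set
    IsMedian C i y = C y ≡ i
      × (∀ y' → C y' ≡ i → sumIn C i (λ x → d x y) ≤ sumIn C i (λ x → d x y'))

    Medians : (Fin n → Fin k) → (Fin k → Fin n) → Set
    Medians C c = ∀ i → IsMedian C i (c i)

    Φ : (Fin n → Fin k) → (Fin k → Fin n) → Carrier
    Φ C c = sumFin (λ i → sumIn C i (λ x → d x (c i)))

    IsOptimal : (Fin n → Fin k) → (Fin k → Fin n) → Set
    IsOptimal C c = IsKClustering C × Medians C c
      × (∀ C' c' → IsKClustering C' → Medians C' c' → Φ C c ≤ Φ C' c')

    clusterSize : (Fin n → Fin k) → Fin k → ℕ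
    clusterSize C i = count (λ x → does (C x ≟ i))

    diffSize : (Fin n → Fin k) → (Fin n → Fin k) → Fin k → Fin k → ℕ
    diffSize C C' i j = count (λ x → does (C x ≟ i) ∧ not (does (C' x ≟ j)))

    distVal : (Fin n → Fin k) → (Fin n → Fin k) → (Fin k → Fin k) → Carrier
    distVal C C' σ = fromℕ n ⁻¹ * sumFin (λ i → fromℕ (diffSize C C' i (σ i)))

    -- dist(C, C') < e, i.e. the minimum over bijections σ is < e
    DistLt : (Fin n → Fin k) → (Fin n → Fin k) → Carrier → Set
    DistLt C C' e = ∃[ σ ] (Bijective _≡_ _≡_ σ × distVal C C' σ < e)

    Property : (CT : Fin n → Fin k) → (α ε OPT : Carrier) → Set
    Property CT α ε OPT =
      IsKClustering CT
      × (∀ C c → IsKClustering C → Medians C c → Φ C c ≤ (1# + α) * OPT → DistLt C CT ε)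
      × (∀ i → (fromℕ 4 + fromℕ 51 / α) * ε * fromℕ n ≤ fromℕ (clusterSize CT i))

    module _ (cs : Fin k → Fin n) where
      IsW : Fin n → Carrier → Set
      IsW x v = (∃[ i ] d x (cs i) ≡ v) × (∀ i → v ≤ d x (cs i))

      IsW₂ : Fin n → Carrier → Set
      IsW₂ x v = ∃[ i ] ∃[ j ] (i ≢ j
        × (∀ l → d x (cs i) ≤ d x (cs l))
        × d x (cs j) ≡ v
        × (∀ l → l ≢ i → v ≤ d x (cs l)))

      Good : Carrier → Fin n → Set
      Good dcrit x = (∀ v → IsW x v → v < dcrit)
        × (∀ v v₂ → IsW x v → IsW₂ x v₂ → fromℕ 17 * dcrit ≤ v₂ - v)

      InX : (Fin n → Fin k) → Carrier → Fin k → Fin n → Set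
      InX Cs dcrit i x = Cs x ≡ i × Good dcrit x

module Submission where

-- Key fact (exchange argument): in an optimal clustering no median is
-- strictly closer to a point than the median of its own cluster, since
-- moving that one point would lower the cost.  Hence a good x ∈ X_i has
-- d(x, c*_i) < d_crit, and a good y ∈ X_j has d(y, c*_i) ≥ w₂(y) - w(y)
-- ≥ 17 d_crit whenever i ≢ j.  A common point z of balls B_{l₁} ∋ x and
-- B_{l₂} ∋ y would give d(y, c*_i) < 4r + d_crit < 17 d_crit along the path
-- y → l₂ → z → l₁ → x → c*_i.  The first claim is the case l₁ = l₂ = z.

open import Defs
open import Data.Nat as ℕ using (ℕ)
open import Data.Fin using (Fin)
open import Data.Product using (∃-syntax; _×_)
open import Relation.Binary.PropositionalEquality using (_≡_; _≢_)
open import Relation.Nullary using (¬_)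

open import Level using (0ℓ)
open import Data.Fin using (zero; suc; _≟_; punchIn)
open import Data.Fin.Properties using (punchInᵢ≢i)
open import Data.Vec.Functional using (replicate)
open import Data.Bool using (if_then_else_)
open import Data.Product using (∃; _,_; proj₁; proj₂)
open import Data.Sum using (_⊎_; inj₁; inj₂)
open import Data.Empty using (⊥-elim)
open import Data.Unit using (⊤; tt)
open import Relation.Nullary using (Dec; yes; no; does; ¬?)
open import Relation.Binary.PropositionalEquality as Eq using (refl; cong; cong₂; subst; subst₂)
open import Algebra.Bundles using (CommutativeRing)
open import Algebra.Structures using (IsCommutativeRing)
open import Relation.Binary.Bundles using (Poset)
open import Relation.Binary.Structures using (IsTotalOrder)

module OrderedFieldFacts (F : OrderedField) where
  open OrderedField F public
  open IsCommutativeRing isCommutativeRing public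
    using (+-assoc; +-comm; +-identityˡ; +-identityʳ; -‿inverseʳ; distribʳ; *-identityˡ; zeroˡ)
  open IsTotalOrder isTotalOrder public
    using (total; antisym) renaming (refl to ≤-refl; reflexive to ≤-reflexive; trans to ≤-trans)

  ring : CommutativeRing 0ℓ 0ℓ
  ring = record { isCommutativeRing = isCommutativeRing }

  poset : Poset 0ℓ 0ℓ 0ℓ
  poset = record { isPartialOrder = IsTotalOrder.isPartialOrder isTotalOrder }

  open import Algebra.Properties.Group (CommutativeRing.+-group ring) using (//-rightDividesʳ)
  open import Relation.Binary.Properties.Poset poset public using (<-irrefl)
  open import Relation.Binary.Reasoning.PartialOrder poset public

  +-monoʳ-≤ : ∀ {a b} c → a ≤ b → c + a ≤ c + b
  +-monoʳ-≤ {a} {b} c a≤b = subst₂ _≤_ (+-comm a c) (+-comm b c) (+-mono-≤ c a≤b)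

  +-mono-≤₂ : ∀ {a b c e} → a ≤ b → c ≤ e → a + c ≤ b + e
  +-mono-≤₂ {b = b} {c} a≤b c≤e = ≤-trans (+-mono-≤ c a≤b) (+-monoʳ-≤ b c≤e)

  +-cancelʳ-≤ : ∀ {a b} c → a + c ≤ b + c → a ≤ b
  +-cancelʳ-≤ {a} {b} c p =
    subst₂ _≤_ (//-rightDividesʳ c a) (//-rightDividesʳ c b) (+-mono-≤ (- c) p)

  +-mono-<-≤ : ∀ {a b c e} → a < b → c ≤ e → a + c < b + e
  +-mono-<-≤ {a} {b} {c} {e} (a≤b , a≢b) c≤e = +-mono-≤₂ a≤b c≤e , λ a+c≡b+e →
    a≢b (antisym a≤b (+-cancelʳ-≤ c (≤-trans (+-monoʳ-≤ b c≤e) (≤-reflexive (Eq.sym a+c≡b+e)))))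

  +-mono-≤-< : ∀ {a b c e} → a ≤ b → c < e → a + c < b + e
  +-mono-≤-< {a} {b} {c} {e} a≤b c<e = subst₂ _<_ (+-comm c a) (+-comm e b) (+-mono-<-≤ c<e a≤b)

  x-y≤x : ∀ x {y} → 0# ≤ y → x - y ≤ x
  x-y≤x x {y} 0≤y = ≤-trans (+-monoʳ-≤ x -y≤0) (≤-reflexive (+-identityʳ x))
    where
    -y≤0 : - y ≤ 0#
    -y≤0 = subst₂ _≤_ (+-identityˡ (- y)) (-‿inverseʳ y) (+-mono-≤ (- y) 0≤y)

  fromℕ-suc-* : ∀ m c → fromℕ (ℕ.suc m) * c ≡ c + fromℕ m * c
  fromℕ-suc-* m c = Eq.trans (distribʳ c 1# (fromℕ m)) (cong (_+ fromℕ m * c) (*-identityˡ c))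

  fromℕ-+-* : ∀ m m' c → fromℕ (m ℕ.+ m') * c ≡ fromℕ m * c + fromℕ m' * c
  fromℕ-+-* ℕ.zero m' c = begin-equality
    fromℕ m' * c             ≡⟨ Eq.sym (+-identityˡ _) ⟩
    0# + fromℕ m' * c        ≡⟨ cong (_+ fromℕ m' * c) (Eq.sym (zeroˡ c)) ⟩
    0# * c + fromℕ m' * c    ∎
  fromℕ-+-* (ℕ.suc m) m' c = begin-equality
    fromℕ (ℕ.suc m ℕ.+ m') * c          ≡⟨ fromℕ-suc-* (m ℕ.+ m') c ⟩
    c + fromℕ (m ℕ.+ m') * c            ≡⟨ cong (c +_) (fromℕ-+-* m m' c) ⟩
    c + (fromℕ m * c + fromℕ m' * c)    ≡⟨ Eq.sym (+-assoc _ _ _) ⟩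
    (c + fromℕ m * c) + fromℕ m' * c    ≡⟨ cong (_+ fromℕ m' * c) (Eq.sym (fromℕ-suc-* m c)) ⟩
    fromℕ (ℕ.suc m) * c + fromℕ m' * c  ∎

  fromℕ-*-nonneg : ∀ m {c} → 0# ≤ c → 0# ≤ fromℕ m * c
  fromℕ-*-nonneg ℕ.zero    {c} 0≤c = ≤-reflexive (Eq.sym (zeroˡ c))
  fromℕ-*-nonneg (ℕ.suc m) {c} 0≤c = begin
    0#                ≡⟨ Eq.sym (+-identityʳ 0#) ⟩
    0# + 0#           ≤⟨ +-mono-≤₂ 0≤c (fromℕ-*-nonneg m 0≤c) ⟩
    c + fromℕ m * c   ≡⟨ Eq.sym (fromℕ-suc-* m c) ⟩
    fromℕ (ℕ.suc m) * c ∎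

  ≤-fromℕ-suc-* : ∀ m {c} → 0# ≤ c → c ≤ fromℕ (ℕ.suc m) * c
  ≤-fromℕ-suc-* m {c} 0≤c = begin
    c                   ≡⟨ Eq.sym (+-identityʳ c) ⟩
    c + 0#              ≤⟨ +-monoʳ-≤ c (fromℕ-*-nonneg m 0≤c) ⟩
    c + fromℕ m * c     ≡⟨ Eq.sym (fromℕ-suc-* m c) ⟩
    fromℕ (ℕ.suc m) * c ∎

  -- 17 c = 4c + 4c + 4c + 4c + c, the arithmetic behind the five-step path.
  seventeen-split : ∀ c → let q = fromℕ 4 * c in fromℕ 17 * c ≡ q + (q + (q + (q + c)))
  seventeen-split c = begin-equality
    fromℕ 17 * c                            ≡⟨ fromℕ-+-* 4 13 c ⟩
    q + fromℕ 13 * c                        ≡⟨ cong (q +_) (fromℕ-+-* 4 9 c) ⟩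
    q + (q + fromℕ 9 * c)                   ≡⟨ cong (λ t → q + (q + t)) (fromℕ-+-* 4 5 c) ⟩
    q + (q + (q + fromℕ 5 * c))             ≡⟨ cong (λ t → q + (q + (q + t))) (fromℕ-+-* 4 1 c) ⟩
    q + (q + (q + (q + fromℕ 1 * c)))       ≡⟨ cong (λ t → q + (q + (q + (q + t)))) one ⟩
    q + (q + (q + (q + c)))                 ∎
    where
    q : Carrier
    q = fromℕ 4 * c
    one : fromℕ 1 * c ≡ c
    one = Eq.trans (fromℕ-suc-* 0 c) (Eq.trans (cong (c +_) (zeroˡ c)) (+-identityʳ c))

  ≮-<-trans : ∀ {a b c} → ¬ (a < b) → a < c → b < c
  ≮-<-trans {a} {b} {c} a≮b a<c with total b c
  ... | inj₁ b≤c = b≤c , λ { refl → a≮b a<c }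
  ... | inj₂ c≤b = ⊥-elim (a≮b (begin-strict a <⟨ a<c ⟩ c ≤⟨ c≤b ⟩ b ∎))

module FiniteSums (F : OrderedField) where
  open OrderedFieldFacts F
  open KMedian F using (sumFin)
  open import Algebra.Properties.Semiring.Sum (CommutativeRing.semiring ring)
    using (sum; ∑-comm; sum-remove; sum-cong-≗; sum-replicate-zero)

  sumFin≡sum : ∀ {m} (f : Fin m → Carrier) → sumFin f ≡ sum f
  sumFin≡sum {ℕ.zero}  f = refl
  sumFin≡sum {ℕ.suc m} f = cong (f zero +_) (sumFin≡sum (λ i → f (suc i)))

  sumFin-cong : ∀ {m} {f g : Fin m → Carrier} → (∀ i → f i ≡ g i) → sumFin f ≡ sumFin g
  sumFin-cong {ℕ.zero}  f≗g = refl
  sumFin-cong {ℕ.suc m} f≗g = cong₂ _+_ (f≗g zero) (sumFin-cong (λ i → f≗g (suc i)))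

  sumFin-comm : ∀ {m m'} (h : Fin m → Fin m' → Carrier) →
    sumFin (λ i → sumFin (h i)) ≡ sumFin (λ j → sumFin (λ i → h i j))
  sumFin-comm h = begin-equality
    sumFin (λ i → sumFin (h i))          ≡⟨ double h ⟩
    sum (λ i → sum (h i))                ≡⟨ ∑-comm h ⟩
    sum (λ j → sum (λ i → h i j))        ≡⟨ Eq.sym (double (λ j i → h i j)) ⟩
    sumFin (λ j → sumFin (λ i → h i j))  ∎
    where
    double : ∀ {m m'} (g : Fin m → Fin m' → Carrier) →
      sumFin (λ i → sumFin (g i)) ≡ sum (λ i → sum (g i))
    double g = Eq.trans (sumFin≡sum (λ i → sumFin (g i))) (sum-cong-≗ (λ i → sumFin≡sum (g i)))

  sumFin-single : ∀ {m} (f : Fin m → Carrier) (j : Fin m) →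
    (∀ i → i ≢ j → f i ≡ 0#) → sumFin f ≡ f j
  sumFin-single {ℕ.suc m} f j vanish = begin-equality
    sumFin f                                 ≡⟨ sumFin≡sum f ⟩
    sum f                                    ≡⟨ sum-remove {i = j} f ⟩
    f j + sum (λ i → f (punchIn j i))        ≡⟨ cong (f j +_) (sum-cong-≗ {m} (λ i → vanish (punchIn j i) (punchInᵢ≢i j i))) ⟩
    f j + sum (replicate m 0#)               ≡⟨ cong (f j +_) (sum-replicate-zero m) ⟩
    f j + 0#                                 ≡⟨ +-identityʳ (f j) ⟩
    f j                                      ∎

  sumFin-mono : ∀ {m} {f g : Fin m → Carrier} → (∀ i → f i ≤ g i) → sumFin f ≤ sumFin g
  sumFin-mono {ℕ.zero}  f≤g = ≤-refl
  sumFin-mono {ℕ.suc m} f≤g = +-mono-≤₂ (f≤g zero) (sumFin-mono (λ i → f≤g (suc i)))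

  sumFin-mono-< : ∀ {m} {f g : Fin m → Carrier} → (∀ i → f i ≤ g i) →
    (j : Fin m) → f j < g j → sumFin f < sumFin g
  sumFin-mono-< f≤g zero    fj<gj = +-mono-<-≤ fj<gj (sumFin-mono (λ i → f≤g (suc i)))
  sumFin-mono-< f≤g (suc j) fj<gj = +-mono-≤-< (f≤g zero) (sumFin-mono-< (λ i → f≤g (suc i)) j fj<gj)

  minimum? : ∀ {m} (f : Fin m → Carrier) (P : Fin m → Set) → (∀ y → Dec (P y)) →
    (∀ y → ¬ P y) ⊎ ∃[ y ] (P y × (∀ y' → P y' → f y ≤ f y'))
  minimum? {ℕ.zero}  f P P? = inj₁ (λ ())
  minimum? {ℕ.suc m} f P P? with minimum? (λ i → f (suc i)) (λ i → P (suc i)) (λ i → P? (suc i)) | P? zero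
  ... | inj₁ none | yes p0 = inj₂ (zero , p0 , λ { zero _ → ≤-refl ; (suc y) p → ⊥-elim (none y p) })
  ... | inj₁ none | no ¬p0 = inj₁ λ { zero → ¬p0 ; (suc y) → none y }
  ... | inj₂ (y , p , min) | no ¬p0 =
    inj₂ (suc y , p , λ { zero p0 → ⊥-elim (¬p0 p0) ; (suc y') p' → min y' p' })
  ... | inj₂ (y , p , min) | yes p0 with total (f zero) (f (suc y))
  ...   | inj₁ f0≤ = inj₂ (zero , p0 , λ { zero _ → ≤-refl ; (suc y') p' → ≤-trans f0≤ (min y' p') })
  ...   | inj₂ ≤f0 = inj₂ (suc y , p , λ { zero _ → ≤f0 ; (suc y') p' → min y' p' })

  minimiser : ∀ {m} (f : Fin m → Carrier) (P : Fin m → Set) → (∀ y → Dec (P y)) →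
    ∃ P → ∃[ y ] (P y × (∀ y' → P y' → f y ≤ f y'))
  minimiser f P P? (y₀ , p₀) with minimum? f P P?
  ... | inj₁ none = ⊥-elim (none y₀ p₀)
  ... | inj₂ min  = min

module KMedianFacts (F : OrderedField) {n k : ℕ}
    (d : Fin n → Fin n → OrderedField.Carrier F) (metric : KMedian.IsMetric F d) where
  open OrderedFieldFacts F
  open FiniteSums F
  open KMedian F
  open IsMetric metric

  -- Distances are nonnegative: if d(x,y) ≤ 0 then 0 = d(x,x) ≤ 2 d(x,y) ≤ d(x,y).
  d-nonneg : ∀ x y → 0# ≤ d x y
  d-nonneg x y with total 0# (d x y)
  ... | inj₁ 0≤dxy = 0≤dxy
  ... | inj₂ dxy≤0 = begin
    0#             ≡⟨ Eq.sym (refl-0 x) ⟩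
    d x x          ≤⟨ triangle x y x ⟩
    d x y + d y x  ≤⟨ +-monoʳ-≤ (d x y) (≤-trans (≤-reflexive (symm y x)) dxy≤0) ⟩
    d x y + 0#     ≡⟨ +-identityʳ (d x y) ⟩
    d x y          ∎

  triangle-path : ∀ a b c e f g → d a g ≤ d a b + (d b c + (d c e + (d e f + d f g)))
  triangle-path a b c e f g = begin
    d a g                                         ≤⟨ triangle a b g ⟩
    d a b + d b g                                 ≤⟨ +-monoʳ-≤ _ (triangle b c g) ⟩
    d a b + (d b c + d c g)                       ≤⟨ +-monoʳ-≤ _ (+-monoʳ-≤ _ (triangle c e g)) ⟩
    d a b + (d b c + (d c e + d e g))             ≤⟨ +-monoʳ-≤ _ (+-monoʳ-≤ _ (+-monoʳ-≤ _ (triangle e f g))) ⟩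
    d a b + (d b c + (d c e + (d e f + d f g)))   ∎

  Φ-pointwise : ∀ (C : Fin n → Fin k) (c : Fin k → Fin n) → Φ d C c ≡ sumFin (λ x → d x (c (C x)))
  Φ-pointwise C c = begin-equality
    Φ d C c                                 ≡⟨ sumFin-comm term ⟩
    sumFin (λ x → sumFin (λ i → term i x))  ≡⟨ sumFin-cong (λ x → sumFin-single (λ i → term i x) (C x) (off x)) ⟩
    sumFin (λ x → term (C x) x)             ≡⟨ sumFin-cong on ⟩
    sumFin (λ x → d x (c (C x)))            ∎
    where
    term : Fin k → Fin n → Carrier
    term i x = if does (C x ≟ i) then d x (c i) else 0#
    off : ∀ x i → i ≢ C x → term i x ≡ 0#
    off x i i≢Cx with C x ≟ i
    ... | yes Cx≡i = ⊥-elim (i≢Cx (Eq.sym Cx≡i))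
    ... | no _     = refl
    on : ∀ x → term (C x) x ≡ d x (c (C x))
    on x with C x ≟ C x
    ... | yes _    = refl
    ... | no Cx≢Cx = ⊥-elim (Cx≢Cx refl)

  medians-exist : ∀ (C : Fin n → Fin k) → IsKClustering d C → ∃[ c ] Medians d C c
  medians-exist C nonempty = (λ i → proj₁ (median i)) , (λ i → proj₂ (median i))
    where
    median : ∀ i → ∃[ y ] IsMedian d C i y
    median i = minimiser (λ y → sumIn d C i (λ x → d x y)) (λ y → C y ≡ i) (λ y → C y ≟ i) (nonempty i)

  medians-minimise : ∀ (C : Fin n → Fin k) (c c' : Fin k → Fin n) →
    Medians d C c → (∀ i → C (c' i) ≡ i) → Φ d C c ≤ Φ d C c'
  medians-minimise C c c' medians c'∈C = sumFin-mono (λ i → proj₂ (medians i) (c' i) (c'∈C i))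

  moveTo : (Fin n → Fin k) → Fin n → Fin k → Fin n → Fin k
  moveTo C x a z = if does (z ≟ x) then a else C z

  -- Exchange argument: in an optimal clustering no median is strictly closer
  -- to a point x than the median of x's own cluster.  Otherwise moving x to
  -- that cluster keeps every cluster nonempty (x is not a median, being at
  -- positive distance from its own) and strictly lowers the cost.
  no-closer-median : ∀ {Cs cs} → IsOptimal d Cs cs → ∀ x a → ¬ (d x (cs a) < d x (cs (Cs x)))
  no-closer-median {Cs} {cs} (_ , medians , optimal) x a closer =
    <-irrefl refl (begin-strict
      Φ d Cs cs                       ≤⟨ optimal C' c' clustering' medians' ⟩
      Φ d C' c'                       ≤⟨ medians-minimise C' c' cs medians' cs∈C' ⟩
      Φ d C' cs                       ≡⟨ Φ-pointwise C' cs ⟩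
      sumFin (λ z → d z (cs (C' z)))  <⟨ sumFin-mono-< cheaper x x-cheaper ⟩
      sumFin (λ z → d z (cs (Cs z)))  ≡⟨ Eq.sym (Φ-pointwise Cs cs) ⟩
      Φ d Cs cs                       ∎)
    where
    C' : Fin n → Fin k
    C' = moveTo Cs x a

    x-not-median : ∀ i → cs i ≢ x
    x-not-median i csi≡x = <-irrefl refl (begin-strict
      0#                ≤⟨ d-nonneg x (cs a) ⟩
      d x (cs a)        <⟨ closer ⟩
      d x (cs (Cs x))   ≡⟨ cong (λ t → d x (cs t)) (Eq.trans (cong Cs (Eq.sym csi≡x)) (proj₁ (medians i))) ⟩
      d x (cs i)        ≡⟨ cong (d x) csi≡x ⟩
      d x x             ≡⟨ refl-0 x ⟩
      0#                ∎)

    cs∈C' : ∀ i → C' (cs i) ≡ i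
    cs∈C' i with cs i ≟ x
    ... | yes csi≡x = ⊥-elim (x-not-median i csi≡x)
    ... | no _      = proj₁ (medians i)

    clustering' : IsKClustering d C'
    clustering' i = cs i , cs∈C' i

    c' : Fin k → Fin n
    c' = proj₁ (medians-exist C' clustering')

    medians' : Medians d C' c'
    medians' = proj₂ (medians-exist C' clustering')

    cheaper : ∀ z → d z (cs (C' z)) ≤ d z (cs (Cs z))
    cheaper z with z ≟ x
    ... | yes refl = proj₁ closer
    ... | no _     = ≤-refl

    x-cheaper : d x (cs (C' x)) < d x (cs (Cs x))
    x-cheaper with x ≟ x
    ... | yes _  = closer
    ... | no x≢x = ⊥-elim (x≢x refl)

-- Good points relative to an optimal clustering Cs with medians cs, for an
-- arbitrary threshold dc (the lemma never uses the value of d_crit).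
module GoodPoints (F : OrderedField) {n k : ℕ}
    (d : Fin n → Fin n → OrderedField.Carrier F) (metric : KMedian.IsMetric F d)
    (Cs : Fin n → Fin k) (cs : Fin k → Fin n) (optimal : KMedian.IsOptimal F d Cs cs)
    (dc : OrderedField.Carrier F) where
  open OrderedFieldFacts F
  open FiniteSums F
  open KMedian F
  open KMedianFacts F {k = k} d metric
  open IsMetric metric

  nearest-median : ∀ x → ∃[ a ] IsW d cs x (d x (cs a))
  nearest-median x with minimiser (λ l → d x (cs l)) (λ _ → ⊤) (λ _ → yes tt) (Cs x , tt)
  ... | a , _ , nearest = a , (a , refl) , (λ l → nearest l tt)

  -- A good point of X_i lies within dc of its own median c*_i, because that
  -- median is as close as a nearest one and w(x) < dc.
  good-near-own : ∀ {i x} → InX d cs Cs dc i x → d x (cs i) < dc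
  good-near-own {x = x} (refl , good) with nearest-median x
  ... | a , isW = ≮-<-trans (no-closer-median optimal x a) (proj₁ good (d x (cs a)) isW)

  -- For a good point y with nearest median a, every other median is at
  -- distance ≥ w₂(y) ≥ w₂(y) - w(y) ≥ 17 dc.
  good-far-from-non-nearest : ∀ {y a l} → Good d cs dc y → IsW d cs y (d y (cs a)) → l ≢ a →
    fromℕ 17 * dc ≤ d y (cs l)
  good-far-from-non-nearest {y} {a} {l} good isW l≢a
    with minimiser (λ m → d y (cs m)) (λ m → m ≢ a) (λ m → ¬? (m ≟ a)) (l , l≢a)
  ... | b , b≢a , second = begin
    fromℕ 17 * dc            ≤⟨ proj₂ good (d y (cs a)) (d y (cs b)) isW isW₂ ⟩
    d y (cs b) - d y (cs a)  ≤⟨ x-y≤x (d y (cs b)) (d-nonneg y (cs a)) ⟩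
    d y (cs b)               ≤⟨ second l l≢a ⟩
    d y (cs l)               ∎
    where
    isW₂ : IsW₂ d cs y (d y (cs b))
    isW₂ = a , b , (λ a≡b → b≢a (Eq.sym a≡b)) , proj₂ isW , refl , second

  -- If c*_i were y's nearest median, then c*_j would be at distance ≥ 17 dc
  -- > w(y), contradicting that optimal clusterings assign nearest medians.
  good-far-from-others : ∀ {i j y} → i ≢ j → InX d cs Cs dc j y → fromℕ 17 * dc ≤ d y (cs i)
  good-far-from-others {i} {j} {y} i≢j (refl , good) with nearest-median y
  ... | a , isW with i ≟ a
  ...   | no i≢a    = good-far-from-non-nearest good isW i≢a
  ...   | yes refl  = ⊥-elim (no-closer-median optimal y a (begin-strict
    d y (cs a)       <⟨ w<dc ⟩
    dc               ≤⟨ ≤-fromℕ-suc-* 16 (≤-trans (d-nonneg y (cs a)) (proj₁ w<dc)) ⟩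
    fromℕ 17 * dc    ≤⟨ good-far-from-non-nearest good isW (λ j≡a → i≢j (Eq.sym j≡a)) ⟩
    d y (cs (Cs y))  ∎))
    where
    w<dc : d y (cs a) < dc
    w<dc = proj₁ good (d y (cs a)) isW

  -- Balls of radius r < 4 dc meeting different good sets X_i ∋ x and X_j ∋ y
  -- are disjoint: a common point z would give the path
  -- y → l₂ → z → l₁ → x → c*_i of length < 4·(4 dc) + dc = 17 dc.
  disjoint-balls : ∀ {r} → r < fromℕ 4 * dc →
    ∀ l₁ l₂ i j → i ≢ j →
    (∃[ x ] (Ball d l₁ r x × InX d cs Cs dc i x)) →
    (∃[ y ] (Ball d l₂ r y × InX d cs Cs dc j y)) →
    ∀ z → ¬ (Ball d l₁ r z × Ball d l₂ r z)
  disjoint-balls {r} r<4dc l₁ l₂ i j i≢j (x , x∈B₁ , x∈Xi) (y , y∈B₂ , y∈Xj) z (z∈B₁ , z∈B₂) =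
    <-irrefl refl (begin-strict
      fromℕ 17 * dc                                          ≤⟨ good-far-from-others i≢j y∈Xj ⟩
      d y (cs i)                                             ≤⟨ triangle-path y l₂ z l₁ x (cs i) ⟩
      d y l₂ + (d l₂ z + (d z l₁ + (d l₁ x + d x (cs i))))   <⟨ path-short ⟩
      q + (q + (q + (q + dc)))                               ≡⟨ Eq.sym (seventeen-split dc) ⟩
      fromℕ 17 * dc                                          ∎)
    where
    q : Carrier
    q = fromℕ 4 * dc

    in-ball : ∀ {s t} → d s t ≤ r → d s t ≤ q
    in-ball s∈B = ≤-trans s∈B (proj₁ r<4dc)

    in-ball′ : ∀ {s t} → d t s ≤ r → d s t ≤ q
    in-ball′ {s} {t} t∈B = in-ball (≤-trans (≤-reflexive (symm s t)) t∈B)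

    path-short : d y l₂ + (d l₂ z + (d z l₁ + (d l₁ x + d x (cs i)))) < q + (q + (q + (q + dc)))
    path-short = +-mono-≤-< (in-ball y∈B₂) (+-mono-≤-< (in-ball′ z∈B₂)
      (+-mono-≤-< (in-ball z∈B₁) (+-mono-≤-< (in-ball′ x∈B₁) (good-near-own x∈Xi))))

  -- A ball of radius r < 4 dc meets at most one good set: two of its points
  -- from different good sets would make the ball disjoint from itself at l.
  one-good-set-per-ball : ∀ {r} → 0# ≤ r → r < fromℕ 4 * dc →
    ∀ l x y i j → Ball d l r x → Ball d l r y →
    InX d cs Cs dc i x → InX d cs Cs dc j y → i ≡ j
  one-good-set-per-ball {r} 0≤r r<4dc l x y i j x∈B y∈B x∈Xi y∈Xj with i ≟ j
  ... | yes i≡j = i≡j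
  ... | no i≢j  = ⊥-elim (disjoint-balls r<4dc l l i j i≢j (x , x∈B , x∈Xi) (y , y∈B , y∈Xj) l (centre , centre))
    where
    centre : Ball d l r l
    centre = subst (_≤ r) (Eq.sym (refl-0 l)) 0≤r

-- Lemma 6.
lemma6 : (F : OrderedField) → let open OrderedField F in let open KMedian F in
    (n k : ℕ) (d : Fin n → Fin n → Carrier) (α ε : Carrier)
    (CT Cs : Fin n → Fin k) (cs : Fin k → Fin n) →
    IsMetric d → 1 ℕ.≤ k → 0# < α → 0# < ε →
    IsOptimal d Cs cs → Property d CT α ε (Φ d Cs cs) →
    let w = Φ d Cs cs / fromℕ n
        dcrit = α * w / (fromℕ 17 * ε)
    in (r : Carrier) → 0# ≤ r → r < fromℕ 4 * dcrit →
      (∀ l x y i j → Ball d l r x → Ball d l r y →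
         InX d cs Cs dcrit i x → InX d cs Cs dcrit j y → i ≡ j)
      × (∀ l₁ l₂ i j → i ≢ j →
         (∃[ x ] (Ball d l₁ r x × InX d cs Cs dcrit i x)) →
         (∃[ y ] (Ball d l₂ r y × InX d cs Cs dcrit j y)) →
         ∀ z → ¬ (Ball d l₁ r z × Ball d l₂ r z))
lemma6 F n k d α ε CT Cs cs metric _ _ _ optimal _ r 0≤r r<4dcrit =
  one-good-set-per-ball 0≤r r<4dcrit , disjoint-balls r<4dcrit
  where
  open OrderedField F
  open GoodPoints F d metric Cs cs optimal (α * (KMedian.Φ F d Cs cs / fromℕ n) / (fromℕ 17 * ε))
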